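{- Let $\sigma$ be a sock pattern of length at least $2$. Then the map $\phi_\sigma$ eventually sorts every sock sequence (i.e. for every sock sequence $p$ there is $k\ge 0$ with $\phi_\sigma^k(p)$ sorted) if and only if $\sigma = aba$.
   Context: A sock sequence is a finite sequence of elements ("socks") of a fixed infinite alphabet $A$. It is sorted if, for each sock, all its occurrences appear consecutively. Two sock sequences are equivalent if one is obtained from the other by a bijective renaming of socks; a sock pattern is an equivalence class, represented by its standardized representative (socks renamed so that first occurrences read $a,b,c,\dots$ in order). A sock sequence contains a pattern $\sigma$ if some (not necessarily consecutive) subsequence of it lies in the class $\sigma$. For a sock pattern $\sigma$, the map $\phi_\sigma$ on sock sequences: read the input left to right, using a stack; let $s$ be the sequence of socks on the stack read from top to bottom. At each step, if input socks remain and pushing the leftmost remaining input sock onto the top of the stack would not make $s$ contain $\sigma$, push it; otherwise pop the top sock of the stack and append it to the output. Continue until all socks are in the output; $\phi_\sigma(p)$ is the output. -}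

module Defs where

open import Data.Nat using (ℕ; zero; suc; _<_; _≤_; _≡ᵇ_)
open import Data.Bool using (Bool; true; false; if_then_else_; _∨_)
open import Data.List using (List; []; _∷_; length; map; _++_; [_])
open import Data.Bool.ListAction using (any)
open import Data.List.Base using (lookup)
open import Data.Fin using (Fin; toℕ)
open import Relation.Binary.PropositionalEquality using (_≡_)
open import Data.List.Relation.Binary.Equality.DecPropositional Data.Nat._≟_ using (_≡?_)
open import Relation.Nullary.Decidable using (⌊_⌋)

SockSeq : Set
SockSeq = List ℕ

subseqs : SockSeq → List SockSeq
subseqs []       = [ [] ]
subseqs (x ∷ xs) = let r = subseqs xs in map (x ∷_) r ++ r

-- Standardization: rename socks so that first occurrences read 0,1,2,...
-- `seen` lists the distinct socks met so far, in order of first occurrence.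
private
  indexOf : ℕ → List ℕ → ℕ
  indexOf x []       = 0
  indexOf x (y ∷ ys) = if x ≡ᵇ y then 0 else suc (indexOf x ys)

  member : ℕ → List ℕ → Bool
  member x = any (x ≡ᵇ_)

std-go : List ℕ → SockSeq → SockSeq
std-go seen []       = []
std-go seen (x ∷ xs) with member x seen
... | true  = indexOf x seen ∷ std-go seen xs
... | false = length seen ∷ std-go (seen ++ [ x ]) xs

std : SockSeq → SockSeq
std = std-go []

-- A sock pattern is represented by its standardized representative.
IsPattern : SockSeq → Set
IsPattern σ = std σ ≡ σ

contains : SockSeq → SockSeq → Bool
contains p σ = any (λ q → ⌊ std q ≡? std σ ⌋) (subseqs p)

-- The stack map φ_σ.  `run input stack` returns the output; the stack is
-- read top to bottom.  `insert x xs st` : x is the leftmost remaining input sock.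
mutual
  run : SockSeq → SockSeq → SockSeq → SockSeq
  run σ []       st = st
  run σ (x ∷ xs) st = insert σ x xs st

  insert : SockSeq → ℕ → SockSeq → SockSeq → SockSeq
  -- empty stack: pushing is the only possible move (for |σ| ≥ 2 a one-sock
  -- stack never contains σ, so this agrees with the rule)
  insert σ x xs []       = run σ xs [ x ]
  insert σ x xs (y ∷ st) =
    if contains (x ∷ y ∷ st) σ
      then y ∷ insert σ x xs st               -- pop y to the output
      else run σ xs (x ∷ y ∷ st)

φ : SockSeq → SockSeq → SockSeq
φ σ p = run σ p []

iter : {A : Set} → (A → A) → ℕ → A → A
iter f zero    a = a
iter f (suc k) a = f (iter f k a)

Sorted : SockSeq → Set
Sorted p = ∀ (i j k : Fin (length p)) → toℕ i < toℕ j → toℕ j < toℕ k →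
           lookup p i ≡ lookup p k → lookup p j ≡ lookup p i

aba : SockSeq
aba = 0 ∷ 1 ∷ 0 ∷ []

module Submission where

-- For σ = aba the stack of φ never contains aba: on the stack the copies of each sock are
-- contiguous. Call a sock scattered in q when its occurrences in q are not consecutive. A pass of
-- φ_aba never scatters a contiguous sock, and if q is not sorted it makes some scattered sock
-- contiguous: if a is the first scattered sock of q, the socks pushed before the first a form
-- complete blocks that stay untouched at the bottom of the stack, and above them every later a
-- is pushed onto the block of a's, since pushing it onto any other sock would create aba.
-- Hence the number of scattered socks decreases until the sequence is sorted.
-- Conversely, for a pattern σ ≠ aba of length at least 2, φ_σ fixes aba, except for σ = aa,
-- where φ_σ swaps abab and baba; either way some sequence is never sorted.

open import Data.Bool using (Bool; true; false; if_then_else_; _∨_)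
open import Data.Bool.Properties using (∨-assoc; ∨-identityʳ; ∨-zeroʳ; ∨-conicalˡ; ∨-conicalʳ; T-≡)
open import Data.Bool.ListAction using (any)
open import Data.Empty using (⊥-elim)
open import Data.Fin using (Fin; zero; suc; toℕ)
open import Data.List using (List; []; _∷_; [_]; length; map; _++_; _ʳ++_; replicate; lookup)
import Data.List.Properties as List
open import Data.Nat using (ℕ; zero; suc; _≤_; _<_; _+_; _≡ᵇ_; z≤n; s≤s)
import Data.Nat.Properties as ℕ
open import Data.List.Relation.Binary.Equality.DecPropositional ℕ._≟_ using (_≡?_)
open import Data.Product using (_×_; _,_; proj₁; proj₂; ∃-syntax)
open import Data.Sum using (_⊎_; inj₁; inj₂)
open import Function.Bundles using (_⇔_; mk⇔; Equivalence)
open import Relation.Binary.PropositionalEquality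
  using (_≡_; _≢_; refl; sym; trans; cong; cong₂; subst; module ≡-Reasoning)
open import Relation.Nullary using (¬_; yes; no)
open import Relation.Nullary.Decidable using (⌊_⌋)

open import Defs

≡ᵇ-refl : ∀ x → (x ≡ᵇ x) ≡ true
≡ᵇ-refl x = Equivalence.to T-≡ (ℕ.≡⇒≡ᵇ x x refl)

≡ᵇ⇒≡ : ∀ x y → (x ≡ᵇ y) ≡ true → x ≡ y
≡ᵇ⇒≡ x y e = ℕ.≡ᵇ⇒≡ x y (Equivalence.from T-≡ e)

≡ᵇ-sym : ∀ x y → (x ≡ᵇ y) ≡ (y ≡ᵇ x)
≡ᵇ-sym zero    zero    = refl
≡ᵇ-sym zero    (suc y) = refl
≡ᵇ-sym (suc x) zero    = refl
≡ᵇ-sym (suc x) (suc y) = ≡ᵇ-sym x y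

replicate-++-∷ : ∀ n (c : ℕ) s → replicate n c ++ c ∷ s ≡ c ∷ replicate n c ++ s
replicate-++-∷ zero    c s = refl
replicate-++-∷ (suc n) c s = cong (c ∷_) (replicate-++-∷ n c s)

replicate-ʳ++ : ∀ n (c : ℕ) s → replicate n c ʳ++ s ≡ replicate n c ++ s
replicate-ʳ++ zero    c s = refl
replicate-ʳ++ (suc n) c s = trans (replicate-ʳ++ n c (c ∷ s)) (replicate-++-∷ n c s)

infix 4 _∈ᵇ_ _∉_

_∈ᵇ_ : ℕ → List ℕ → Bool
x ∈ᵇ []       = false
x ∈ᵇ (y ∷ ys) = (x ≡ᵇ y) ∨ (x ∈ᵇ ys)

-- A record rather than an abbreviation of (x ∈ᵇ l) ≡ false, so that x and l can be inferred.
record _∉_ (x : ℕ) (l : List ℕ) : Set where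
  constructor absent
  field absence : (x ∈ᵇ l) ≡ false
open _∉_

∈ᵇ-head : ∀ x l → (x ∈ᵇ x ∷ l) ≡ true
∈ᵇ-head x l rewrite ≡ᵇ-refl x = refl

∈ᵇ-++ : ∀ x l m → (x ∈ᵇ l ++ m) ≡ (x ∈ᵇ l) ∨ (x ∈ᵇ m)
∈ᵇ-++ x []      m = refl
∈ᵇ-++ x (y ∷ l) m rewrite ∈ᵇ-++ x l m = sym (∨-assoc (x ≡ᵇ y) (x ∈ᵇ l) (x ∈ᵇ m))

∈ᵇ-++-∷ : ∀ x l m → (x ∈ᵇ l ++ x ∷ m) ≡ true
∈ᵇ-++-∷ x l m rewrite ∈ᵇ-++ x l (x ∷ m) | ∈ᵇ-head x m = ∨-zeroʳ (x ∈ᵇ l)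

∈ᵇ-lookup : ∀ l (i : Fin (length l)) → (lookup l i ∈ᵇ l) ≡ true
∈ᵇ-lookup (x ∷ l) zero    = ∈ᵇ-head x l
∈ᵇ-lookup (x ∷ l) (suc i) rewrite ∈ᵇ-lookup l i = ∨-zeroʳ (lookup l i ≡ᵇ x)

∈ᵇ⇒¬∉ : ∀ {x l} → (x ∈ᵇ l) ≡ true → ¬ x ∉ l
∈ᵇ⇒¬∉ x∈ (absent x∉) with () ← trans (sym x∈) x∉

∈ᵇ-replicate⇒≡ : ∀ {x a} n → (x ∈ᵇ replicate n a) ≡ true → x ≡ a
∈ᵇ-replicate⇒≡ {x} {a} (suc n) x∈ with x ≡ᵇ a in x≡a
... | true  = ≡ᵇ⇒≡ x a x≡a
... | false = ∈ᵇ-replicate⇒≡ n x∈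

∉-[] : ∀ {x} → x ∉ []
∉-[] = absent refl

∉-head : ∀ {x y ys} → x ∉ y ∷ ys → (x ≡ᵇ y) ≡ false
∉-head {x} {y} {ys} (absent x∉) = ∨-conicalˡ (x ≡ᵇ y) (x ∈ᵇ ys) x∉

∉-tail : ∀ {x y ys} → x ∉ y ∷ ys → x ∉ ys
∉-tail {x} {y} {ys} (absent x∉) = absent (∨-conicalʳ (x ≡ᵇ y) (x ∈ᵇ ys) x∉)

∉-cons : ∀ {x y ys} → (x ≡ᵇ y) ≡ false → x ∉ ys → x ∉ y ∷ ys
∉-cons x≢y (absent x∉ys) = absent (cong₂ _∨_ x≢y x∉ys)

∉-[_] : ∀ {x y ys} → x ∉ y ∷ ys → x ∉ [ y ]
∉-[ x∉ ] = ∉-cons (∉-head x∉) ∉-[]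

∉-replicate : ∀ {x a} n → (x ≡ᵇ a) ≡ false → x ∉ replicate n a
∉-replicate zero    x≢a = ∉-[]
∉-replicate (suc n) x≢a = ∉-cons x≢a (∉-replicate n x≢a)

∈ᵇ∧∉⇒≢ᵇ : ∀ a x l → (a ∈ᵇ l) ≡ true → x ∉ l → (a ≡ᵇ x) ≡ false
∈ᵇ∧∉⇒≢ᵇ a x l a∈l x∉l with a ≡ᵇ x in a≡x
... | true  = ⊥-elim (∈ᵇ⇒¬∉ (subst (λ y → (y ∈ᵇ l) ≡ true) (≡ᵇ⇒≡ a x a≡x) a∈l) x∉l)
... | false = refl

Disjoint : List ℕ → List ℕ → Set
Disjoint b l = ∀ z → (z ∈ᵇ b) ≡ true → z ∉ l

Disjoint-[] : ∀ b → Disjoint b []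
Disjoint-[] b z _ = ∉-[]

∉-++⁻ʳ : ∀ {x} l {m} → x ∉ l ++ m → x ∉ m
∉-++⁻ʳ []      x∉ = x∉
∉-++⁻ʳ (y ∷ l) x∉ = ∉-++⁻ʳ l (∉-tail x∉)

Disjoint-++ : ∀ {b₁ b₂ l} → Disjoint b₁ l → Disjoint b₂ l → Disjoint (b₁ ++ b₂) l
Disjoint-++ {b₁} {b₂} d₁ d₂ z z∈ with z ∈ᵇ b₁ in z∈b₁
... | true  = d₁ z z∈b₁
... | false = d₂ z (trans (sym (cong (_∨ (z ∈ᵇ b₂)) z∈b₁)) (trans (sym (∈ᵇ-++ z b₁ b₂)) z∈))

Disjoint-replicate : ∀ {x l} n → x ∉ l → Disjoint (replicate n x) l
Disjoint-replicate {x} n x∉l z z∈ with refl ← ∈ᵇ-replicate⇒≡ n z∈ = x∉l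

Disjoint-head : ∀ {b x l} → Disjoint b (x ∷ l) → x ∉ b
Disjoint-head {b} {x} {l} d with x ∈ᵇ b in x∈b
... | true  = ⊥-elim (∈ᵇ⇒¬∉ (∈ᵇ-head x l) (d x x∈b))
... | false = absent x∈b

Disjoint-tail : ∀ {b x l} → Disjoint b (x ∷ l) → Disjoint b l
Disjoint-tail d z z∈b = ∉-tail (d z z∈b)

Disjoint-cons : ∀ {b x l} → x ∉ b → Disjoint b l → Disjoint b (x ∷ l)
Disjoint-cons {b} {x} x∉b d z z∈b = ∉-cons (∈ᵇ∧∉⇒≢ᵇ z x b z∈b x∉b) (d z z∈b)

-- reappears x l holds iff x ∷ l contains aba with its first a at the head.
reappears : ℕ → List ℕ → Bool
reappears x []       = false
reappears x (y ∷ ys) = if x ≡ᵇ y then reappears x ys else x ∈ᵇ ys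

hasABA : List ℕ → Bool
hasABA []       = false
hasABA (x ∷ xs) = reappears x xs ∨ hasABA xs

AbaFree : List ℕ → Set
AbaFree l = hasABA l ≡ false

scattered : ℕ → List ℕ → Bool
scattered a []       = false
scattered a (x ∷ xs) = if a ≡ᵇ x then reappears a xs else scattered a xs

reappears-∉ : ∀ {x} l → x ∉ l → reappears x l ≡ false
reappears-∉ []       _   = refl
reappears-∉ (y ∷ ys) x∉ rewrite ∉-head x∉ = absence (∉-tail x∉)

any-++ : ∀ (p : SockSeq → Bool) l m → any p (l ++ m) ≡ any p l ∨ any p m
any-++ p []      m = refl
any-++ p (q ∷ l) m rewrite any-++ p l m = sym (∨-assoc (p q) (any p l) (any p m))

any-map : ∀ (p : SockSeq → Bool) (g : SockSeq → SockSeq) l → any p (map g l) ≡ any (λ q → p (g q)) l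
any-map p g []      = refl
any-map p g (q ∷ l) = cong (p (g q) ∨_) (any-map p g l)

any-subseqs-∷ : ∀ (p : SockSeq → Bool) x xs →
  any p (subseqs (x ∷ xs)) ≡ any (λ q → p (x ∷ q)) (subseqs xs) ∨ any p (subseqs xs)
any-subseqs-∷ p x xs = trans (any-++ p (map (x ∷_) (subseqs xs)) (subseqs xs))
                             (cong (_∨ any p (subseqs xs)) (any-map p (x ∷_) (subseqs xs)))

any-false : ∀ (p : SockSeq → Bool) l → (∀ q → p q ≡ false) → any p l ≡ false
any-false p []      p≡false = refl
any-false p (q ∷ l) p≡false rewrite p≡false q = any-false p l p≡false

any-subseqs-[] : ∀ (p : SockSeq → Bool) l → p [] ≡ true → any p (subseqs l) ≡ true
any-subseqs-[] p []      p[] rewrite p[] = refl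
any-subseqs-[] p (x ∷ l) p[] rewrite any-subseqs-∷ p x l | any-subseqs-[] p l p[] = ∨-zeroʳ _

any-subseqs-short : ∀ (p : SockSeq → Bool) l → (∀ q → length q ≤ length l → p q ≡ false) →
  any p (subseqs l) ≡ false
any-subseqs-short p []      short rewrite short [] z≤n = refl
any-subseqs-short p (x ∷ l) short
  rewrite any-subseqs-∷ p x l
        | any-subseqs-short (λ q → p (x ∷ q)) l (λ q q≤l → short (x ∷ q) (s≤s q≤l))
        | any-subseqs-short p l (λ q q≤l → short q (ℕ.m≤n⇒m≤1+n q≤l)) = refl

length-std-go : ∀ seen l → length (std-go seen l) ≡ length l
length-std-go seen []       = refl
length-std-go seen (x ∷ xs) with any (x ≡ᵇ_) seen
... | true  = cong suc (length-std-go seen xs)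
... | false = cong suc (length-std-go _ xs)

≢⇒≡?-false : ∀ (l m : List ℕ) → l ≢ m → ⌊ l ≡? m ⌋ ≡ false
≢⇒≡?-false l m l≢m with l ≡? m
... | yes l≡m = ⊥-elim (l≢m l≡m)
... | no  _   = refl

contains-short : ∀ σ l → length l < length σ → contains l σ ≡ false
contains-short σ l l<σ = any-subseqs-short _ l λ q q≤l → ≢⇒≡?-false (std q) (std σ) λ q~σ →
  ℕ.<-irrefl (length-std-go [] σ) (begin-strict
    length (std σ) ≡⟨ cong length q~σ ⟨
    length (std q) ≡⟨ length-std-go [] q ⟩
    length q       ≤⟨ q≤l ⟩
    length l       <⟨ l<σ ⟩
    length σ       ∎)
  where open ℕ.≤-Reasoning

isABA : SockSeq → Bool
isABA q = ⌊ std q ≡? aba ⌋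

isABA-length : ∀ q → length q ≢ 3 → isABA q ≡ false
isABA-length q q≢3 = ≢⇒≡?-false (std q) aba λ q~aba →
  q≢3 (trans (sym (length-std-go [] q)) (cong length q~aba))

isABA-xx : ∀ x r → isABA (x ∷ x ∷ r) ≡ false
isABA-xx x r rewrite ≡ᵇ-refl x | ≡ᵇ-refl x = refl

isABA-xyx : ∀ x y → (y ≡ᵇ x) ≡ false → isABA (x ∷ y ∷ x ∷ []) ≡ true
isABA-xyx x y y≢x rewrite y≢x | ≡ᵇ-refl x | ≡ᵇ-refl x = refl

isABA-xyz : ∀ x y z → (y ≡ᵇ x) ≡ false → (z ≡ᵇ x) ≡ false → ∀ r → isABA (x ∷ y ∷ z ∷ r) ≡ false
isABA-xyz x y z y≢x z≢x [] with z ≡ᵇ y in z≡y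
... | true  rewrite y≢x | z≢x | z≡y | z≢x = refl
... | false rewrite y≢x | z≢x | z≡y = refl
isABA-xyz x y z y≢x z≢x (w ∷ r) = isABA-length (x ∷ y ∷ z ∷ w ∷ r) λ ()

any-isABA-xy : ∀ x y → (y ≡ᵇ x) ≡ false → ∀ q → any (λ r → isABA (x ∷ y ∷ r)) (subseqs q) ≡ (x ∈ᵇ q)
any-isABA-xy x y y≢x [] rewrite isABA-length (x ∷ y ∷ []) (λ ()) = refl
any-isABA-xy x y y≢x (z ∷ zs)
  rewrite any-subseqs-∷ (λ r → isABA (x ∷ y ∷ r)) z zs | any-isABA-xy x y y≢x zs
  with z ≡ᵇ x in z≡x
... | true  rewrite ≡ᵇ⇒≡ z x z≡x | ≡ᵇ-refl x
                  | any-subseqs-[] (λ r → isABA (x ∷ y ∷ x ∷ r)) zs (isABA-xyx x y y≢x) = refl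
... | false rewrite ≡ᵇ-sym x z | z≡x
                  | any-false (λ r → isABA (x ∷ y ∷ z ∷ r)) (subseqs zs) (isABA-xyz x y z y≢x z≡x) = refl

any-isABA-x : ∀ x q → any (λ r → isABA (x ∷ r)) (subseqs q) ≡ reappears x q
any-isABA-x x [] rewrite isABA-length (x ∷ []) (λ ()) = refl
any-isABA-x x (y ∷ ys) rewrite any-subseqs-∷ (λ r → isABA (x ∷ r)) y ys | any-isABA-x x ys
  with x ≡ᵇ y in x≡y
... | true  rewrite ≡ᵇ⇒≡ x y x≡y | any-false (λ r → isABA (y ∷ y ∷ r)) (subseqs ys) (isABA-xx y) = refl
... | false rewrite any-isABA-xy x y (trans (≡ᵇ-sym y x) x≡y) ys with x ∈ᵇ ys in x∈ys
...   | true  = refl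
...   | false = reappears-∉ ys (absent x∈ys)

contains-aba : ∀ l → contains l aba ≡ hasABA l
contains-aba []       = refl
contains-aba (x ∷ xs) = trans (any-subseqs-∷ isABA x xs) (cong₂ _∨_ (any-isABA-x x xs) (contains-aba xs))

reappears-++-∉ : ∀ x l {b} → x ∉ b → reappears x (l ++ b) ≡ reappears x l
reappears-++-∉ x []      x∉b = reappears-∉ _ x∉b
reappears-++-∉ x (y ∷ l) {b} x∉b with x ≡ᵇ y
... | true  = reappears-++-∉ x l x∉b
... | false rewrite ∈ᵇ-++ x l b | absence x∉b = ∨-identityʳ (x ∈ᵇ l)

hasABA-++-disjoint : ∀ {b} → AbaFree b → ∀ l → Disjoint b l → hasABA (l ++ b) ≡ hasABA l
hasABA-++-disjoint b-free []      _ = b-free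
hasABA-++-disjoint {b} b-free (x ∷ l) d
  rewrite reappears-++-∉ x l (Disjoint-head {b} d)
        | hasABA-++-disjoint {b} b-free l (Disjoint-tail {b} d) = refl

reappears-replicate-++ : ∀ c n s → reappears c (replicate n c ++ s) ≡ reappears c s
reappears-replicate-++ c zero    s = refl
reappears-replicate-++ c (suc n) s rewrite ≡ᵇ-refl c = reappears-replicate-++ c n s

reappears-replicate : ∀ x a n → reappears x (replicate n a) ≡ false
reappears-replicate x a zero    = refl
reappears-replicate x a (suc n) with x ≡ᵇ a in x≡a
... | true  = reappears-replicate x a n
... | false = absence (∉-replicate n x≡a)

hasABA-replicate-++ : ∀ c n {s} → c ∉ s → hasABA (replicate n c ++ s) ≡ hasABA s
hasABA-replicate-++ c zero    c∉s = refl
hasABA-replicate-++ c (suc n) {s} c∉s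
  rewrite reappears-replicate-++ c n s | reappears-∉ s c∉s = hasABA-replicate-++ c n c∉s

AbaFree-replicate : ∀ a n → AbaFree (replicate n a)
AbaFree-replicate a n = subst AbaFree (List.++-identityʳ (replicate n a)) (hasABA-replicate-++ a n ∉-[])

AbaFree-∷-replicate : ∀ x a n → AbaFree (x ∷ replicate n a)
AbaFree-∷-replicate x a n = cong₂ _∨_ (reappears-replicate x a n) (AbaFree-replicate a n)

hasABA-∷-dup : ∀ x c r → (x ≡ᵇ c) ≡ false → hasABA (x ∷ c ∷ c ∷ r) ≡ hasABA (x ∷ c ∷ r)
hasABA-∷-dup x c r x≢c rewrite x≢c | ≡ᵇ-refl c with x ∈ᵇ r | reappears c r
... | true  | _     = refl
... | false | true  = refl
... | false | false = refl

hasABA-xyx : ∀ a y r → (a ≡ᵇ y) ≡ false → (a ∈ᵇ r) ≡ true → hasABA (a ∷ y ∷ r) ≡ true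
hasABA-xyx a y r a≢y a∈r rewrite a≢y | a∈r = refl

AbaFree-ʳ++ : ∀ u {s} → AbaFree (u ʳ++ s) → AbaFree s
AbaFree-ʳ++ []      free = free
AbaFree-ʳ++ (x ∷ u) {s} free = ∨-conicalʳ (reappears x s) (hasABA s) (AbaFree-ʳ++ u free)

insert-push : ∀ x xs st → AbaFree (x ∷ st) → insert aba x xs st ≡ run aba xs (x ∷ st)
insert-push x xs []       _    = refl
insert-push x xs (y ∷ st) free rewrite contains-aba (x ∷ y ∷ st) | free = refl

insert-pop : ∀ x xs y st → hasABA (x ∷ y ∷ st) ≡ true → insert aba x xs (y ∷ st) ≡ y ∷ insert aba x xs st
insert-pop x xs y st hit rewrite contains-aba (x ∷ y ∷ st) | hit = refl

run-push : ∀ u v s → AbaFree (u ʳ++ s) → run aba (u ++ v) s ≡ run aba v (u ʳ++ s)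
run-push []      v s free = refl
run-push (x ∷ u) v s free =
  trans (insert-push x (u ++ v) s (AbaFree-ʳ++ u free)) (run-push u v (x ∷ s) free)

run-push-block : ∀ c n l s → c ∉ s → AbaFree s → run aba (replicate n c ++ l) s ≡ run aba l (replicate n c ++ s)
run-push-block c n l s c∉s free =
  trans (run-push (replicate n c) l s (subst AbaFree (sym reversed) (trans (hasABA-replicate-++ c n c∉s) free)))
        (cong (run aba l) reversed)
  where reversed = replicate-ʳ++ n c s

mutual
  ∉-run : ∀ {c} xs st → c ∉ xs → c ∉ st → c ∉ run aba xs st
  ∉-run []       st _    c∉st = c∉st
  ∉-run (x ∷ xs) st c∉xs c∉st = ∉-insert x xs st c∉xs c∉st

  ∉-insert : ∀ {c} x xs st → c ∉ x ∷ xs → c ∉ st → c ∉ insert aba x xs st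
  ∉-insert x xs []       c∉xs _    = ∉-run xs [ x ] (∉-tail c∉xs) ∉-[ c∉xs ]
  ∉-insert x xs (y ∷ st) c∉xs c∉st with hasABA (x ∷ y ∷ st) in hit
  ... | true  rewrite insert-pop x xs y st hit =
    ∉-cons (∉-head c∉st) (∉-insert x xs st c∉xs (∉-tail c∉st))
  ... | false rewrite insert-push x xs (y ∷ st) hit =
    ∉-run xs (x ∷ y ∷ st) (∉-tail c∉xs) (∉-cons (∉-head c∉xs) c∉st)

mutual
  run-ignores-bottom : ∀ {b} → AbaFree b → ∀ xs t → Disjoint b xs → Disjoint b t →
    run aba xs (t ++ b) ≡ run aba xs t ++ b
  run-ignores-bottom free []       t _   _  = refl
  run-ignores-bottom free (x ∷ xs) t dxs dt = insert-ignores-bottom free x xs t dxs dt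

  insert-ignores-bottom : ∀ {b} → AbaFree b → ∀ x xs t → Disjoint b (x ∷ xs) → Disjoint b t →
    insert aba x xs (t ++ b) ≡ insert aba x xs t ++ b
  insert-ignores-bottom {b} free x xs [] dxs _ =
    trans (insert-push x xs b (hasABA-++-disjoint {b} free [ x ] dx))
          (run-ignores-bottom free xs [ x ] (Disjoint-tail {b} dxs) dx)
    where dx = Disjoint-cons (Disjoint-head {b} dxs) (Disjoint-[] b)
  insert-ignores-bottom {b} free x xs (y ∷ t) dxs dt
    with hasABA (x ∷ y ∷ t) in hit
       | hasABA-++-disjoint {b} free (x ∷ y ∷ t) (Disjoint-cons (Disjoint-head {b} dxs) dt)
  ... | true  | same rewrite insert-pop x xs y (t ++ b) same | insert-pop x xs y t hit =
    cong (y ∷_) (insert-ignores-bottom free x xs t dxs (Disjoint-tail {b} dt))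
  ... | false | same rewrite insert-push x xs (y ∷ t ++ b) same | insert-push x xs (y ∷ t) hit =
    run-ignores-bottom free xs (x ∷ y ∷ t) (Disjoint-tail {b} dxs)
      (Disjoint-cons (Disjoint-head {b} dxs) dt)

GatheredAtEnd : ℕ → SockSeq → Set
GatheredAtEnd a r = ∃[ w ] ∃[ m ] (r ≡ w ++ a ∷ replicate m a) × a ∉ w

mutual
  run-gathers-bottom-block : ∀ a xs t k → a ∉ t → GatheredAtEnd a (run aba xs (t ++ a ∷ replicate k a))
  run-gathers-bottom-block a []       t k a∉t = t , k , refl , a∉t
  run-gathers-bottom-block a (x ∷ xs) t k a∉t = insert-gathers-bottom-block a x xs t k a∉t

  insert-gathers-bottom-block : ∀ a x xs t k → a ∉ t →
    GatheredAtEnd a (insert aba x xs (t ++ a ∷ replicate k a))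
  insert-gathers-bottom-block a x xs [] k _
    rewrite insert-push x xs (a ∷ replicate k a) (AbaFree-∷-replicate x a (suc k))
    with x ≡ᵇ a in x≡a
  ... | true  with refl ← ≡ᵇ⇒≡ x a x≡a = run-gathers-bottom-block a xs [] (suc k) ∉-[]
  ... | false = run-gathers-bottom-block a xs [ x ] k (∉-cons (trans (≡ᵇ-sym a x) x≡a) ∉-[])
  insert-gathers-bottom-block a x xs (y ∷ t) k a∉t with hasABA (x ∷ y ∷ t ++ a ∷ replicate k a) in hit
  ... | true  rewrite insert-pop x xs y (t ++ a ∷ replicate k a) hit
    with insert-gathers-bottom-block a x xs t k (∉-tail a∉t)
  ...   | w , m , eq , a∉w = y ∷ w , m , cong (y ∷_) eq , ∉-cons (∉-head a∉t) a∉w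
  insert-gathers-bottom-block a x xs (y ∷ t) k a∉t
      | false rewrite insert-push x xs (y ∷ t ++ a ∷ replicate k a) hit
    with x ≡ᵇ a in x≡a
  ...   | true  with refl ← ≡ᵇ⇒≡ x a x≡a
    with () ← trans (sym hit)
                (hasABA-xyx a y (t ++ a ∷ replicate k a) (∉-head a∉t) (∈ᵇ-++-∷ a t (replicate k a)))
  ...   | false = run-gathers-bottom-block a xs (x ∷ y ∷ t) k (∉-cons (trans (≡ᵇ-sym a x) x≡a) a∉t)

insert-pops-block : ∀ x xs c k s → (x ≡ᵇ c) ≡ false → hasABA (x ∷ c ∷ replicate k c ++ s) ≡ true →
  insert aba x xs (replicate k c ++ s) ≡ replicate k c ++ insert aba x xs s
insert-pops-block x xs c zero    s x≢c hit = refl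
insert-pops-block x xs c (suc k) s x≢c hit
  = trans (insert-pop x xs c (replicate k c ++ s) hit′)
          (cong (c ∷_) (insert-pops-block x xs c k s x≢c hit′))
  where hit′ = trans (sym (hasABA-∷-dup x c (replicate k c ++ s) x≢c)) hit

SingleBlock : ℕ → ℕ → SockSeq → Set
SingleBlock c k r = ∃[ w₁ ] ∃[ w₂ ] (r ≡ w₁ ++ c ∷ replicate k c ++ w₂) × c ∉ w₁ × c ∉ w₂

SingleBlock-∷ : ∀ {c k y r} → (c ≡ᵇ y) ≡ false → SingleBlock c k r → SingleBlock c k (y ∷ r)
SingleBlock-∷ {y = y} c≢y (w₁ , w₂ , eq , c∉w₁ , c∉w₂) =
  y ∷ w₁ , w₂ , cong (y ∷_) eq , ∉-cons c≢y c∉w₁ , c∉w₂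

mutual
  run-keeps-stack-block : ∀ c k xs t s → c ∉ xs → c ∉ t → c ∉ s →
    SingleBlock c k (run aba xs (t ++ c ∷ replicate k c ++ s))
  run-keeps-stack-block c k []       t s _    c∉t c∉s = t , s , refl , c∉t , c∉s
  run-keeps-stack-block c k (x ∷ xs) t s c∉xs c∉t c∉s =
    insert-keeps-stack-block c k x xs t s c∉xs c∉t c∉s

  insert-keeps-stack-block : ∀ c k x xs t s → c ∉ x ∷ xs → c ∉ t → c ∉ s →
    SingleBlock c k (insert aba x xs (t ++ c ∷ replicate k c ++ s))
  insert-keeps-stack-block c k x xs [] s c∉xs _ c∉s with hasABA (x ∷ c ∷ replicate k c ++ s) in hit
  ... | true  rewrite insert-pop x xs c (replicate k c ++ s) hit
                    | insert-pops-block x xs c k s (trans (≡ᵇ-sym x c) (∉-head c∉xs)) hit =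
    [] , insert aba x xs s , refl , ∉-[] , ∉-insert x xs s c∉xs c∉s
  ... | false rewrite insert-push x xs (c ∷ replicate k c ++ s) hit =
    run-keeps-stack-block c k xs [ x ] s (∉-tail c∉xs) ∉-[ c∉xs ] c∉s
  insert-keeps-stack-block c k x xs (y ∷ t) s c∉xs c∉t c∉s
    with hasABA (x ∷ y ∷ t ++ c ∷ replicate k c ++ s) in hit
  ... | true  rewrite insert-pop x xs y (t ++ c ∷ replicate k c ++ s) hit =
    SingleBlock-∷ (∉-head c∉t) (insert-keeps-stack-block c k x xs t s c∉xs (∉-tail c∉t) c∉s)
  ... | false rewrite insert-push x xs (y ∷ t ++ c ∷ replicate k c ++ s) hit =
    run-keeps-stack-block c k xs (x ∷ y ∷ t) s (∉-tail c∉xs) (∉-cons (∉-head c∉xs) c∉t) c∉s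

mutual
  run-keeps-input-block : ∀ c k l₁ l₂ s → c ∉ l₁ → c ∉ l₂ → c ∉ s → AbaFree s →
    SingleBlock c k (run aba (l₁ ++ c ∷ replicate k c ++ l₂) s)
  run-keeps-input-block c k [] l₂ s _ c∉l₂ c∉s free =
    subst (SingleBlock c k) (sym (run-push-block c (suc k) l₂ s c∉s free))
      (run-keeps-stack-block c k l₂ [] s c∉l₂ ∉-[] c∉s)
  run-keeps-input-block c k (x ∷ l₁) l₂ s c∉l₁ c∉l₂ c∉s free =
    insert-keeps-input-block c k x l₁ l₂ s c∉l₁ c∉l₂ c∉s free

  insert-keeps-input-block : ∀ c k x l₁ l₂ s → c ∉ x ∷ l₁ → c ∉ l₂ → c ∉ s → AbaFree s →
    SingleBlock c k (insert aba x (l₁ ++ c ∷ replicate k c ++ l₂) s)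
  insert-keeps-input-block c k x l₁ l₂ [] c∉l₁ c∉l₂ _ _ =
    run-keeps-input-block c k l₁ l₂ [ x ] (∉-tail c∉l₁) c∉l₂ ∉-[ c∉l₁ ] refl
  insert-keeps-input-block c k x l₁ l₂ (y ∷ s) c∉l₁ c∉l₂ c∉s free with hasABA (x ∷ y ∷ s) in hit
  ... | true  rewrite insert-pop x (l₁ ++ c ∷ replicate k c ++ l₂) y s hit =
    SingleBlock-∷ (∉-head c∉s)
      (insert-keeps-input-block c k x l₁ l₂ s c∉l₁ c∉l₂ (∉-tail c∉s)
        (∨-conicalʳ (reappears y s) (hasABA s) free))
  ... | false rewrite insert-push x (l₁ ++ c ∷ replicate k c ++ l₂) (y ∷ s) hit =
    run-keeps-input-block c k l₁ l₂ (x ∷ y ∷ s) (∉-tail c∉l₁) c∉l₂ (∉-cons (∉-head c∉l₁) c∉s) hit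

scattered⇒∈ᵇ : ∀ a q → scattered a q ≡ true → (a ∈ᵇ q) ≡ true
scattered⇒∈ᵇ a (x ∷ xs) sc with a ≡ᵇ x
... | true  = refl
... | false = scattered⇒∈ᵇ a xs sc

scattered-∉ : ∀ {c} l → c ∉ l → scattered c l ≡ false
scattered-∉ []       _   = refl
scattered-∉ (x ∷ xs) c∉ rewrite ∉-head c∉ = scattered-∉ xs (∉-tail c∉)

scattered-replicate-++ : ∀ a x k l → (a ≡ᵇ x) ≡ false → scattered a (replicate k x ++ l) ≡ scattered a l
scattered-replicate-++ a x zero    l a≢x = refl
scattered-replicate-++ a x (suc k) l a≢x rewrite a≢x = scattered-replicate-++ a x k l a≢x

¬reappears⇒leadingBlock : ∀ c xs → reappears c xs ≡ false →
  ∃[ k ] ∃[ l ] (xs ≡ replicate k c ++ l) × c ∉ l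
¬reappears⇒leadingBlock c []       _ = 0 , [] , refl , ∉-[]
¬reappears⇒leadingBlock c (y ∷ ys) ¬re with c ≡ᵇ y in c≡y
... | true  with refl ← ≡ᵇ⇒≡ c y c≡y with ¬reappears⇒leadingBlock c ys ¬re
...   | k , l , eq , c∉l = suc k , l , cong (c ∷_) eq , c∉l
¬reappears⇒leadingBlock c (y ∷ ys) ¬re | false = 0 , y ∷ ys , refl , ∉-cons c≡y (absent ¬re)

contiguous⇒SingleBlock : ∀ c q → (c ∈ᵇ q) ≡ true → scattered c q ≡ false → ∃[ k ] SingleBlock c k q
contiguous⇒SingleBlock c (x ∷ xs) c∈ ¬sc with c ≡ᵇ x in c≡x
... | true  with refl ← ≡ᵇ⇒≡ c x c≡x with ¬reappears⇒leadingBlock c xs ¬sc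
...   | k , l , eq , c∉l = k , [] , l , cong (c ∷_) eq , ∉-[] , c∉l
contiguous⇒SingleBlock c (x ∷ xs) c∈ ¬sc | false =
  let k , block = contiguous⇒SingleBlock c xs c∈ ¬sc in k , SingleBlock-∷ c≡x block

SingleBlock⇒contiguous : ∀ {c k r} → SingleBlock c k r → scattered c r ≡ false
SingleBlock⇒contiguous {c} {k} (w₁ , w₂ , refl , c∉w₁ , c∉w₂) = go w₁ c∉w₁
  where
  go : ∀ w₁ → c ∉ w₁ → scattered c (w₁ ++ c ∷ replicate k c ++ w₂) ≡ false
  go []       _    rewrite ≡ᵇ-refl c | reappears-replicate-++ c k w₂ = reappears-∉ w₂ c∉w₂
  go (x ∷ w₁) c∉w₁ rewrite ∉-head c∉w₁ = go w₁ (∉-tail c∉w₁)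

φ-preserves-contiguity : ∀ c q → scattered c q ≡ false → scattered c (φ aba q) ≡ false
φ-preserves-contiguity c q ¬sc with c ∈ᵇ q in c∈q
... | false = scattered-∉ (φ aba q) (∉-run q [] (absent c∈q) ∉-[])
... | true  with contiguous⇒SingleBlock c q c∈q ¬sc
...   | k , l₁ , l₂ , refl , c∉l₁ , c∉l₂ =
  SingleBlock⇒contiguous (run-keeps-input-block c k l₁ l₂ [] c∉l₁ c∉l₂ ∉-[] refl)

pushLeadingBlock : ∀ x k l s → AbaFree s → Disjoint s (x ∷ replicate k x ++ l) → x ∉ l →
  AbaFree (replicate (suc k) x ʳ++ s) × Disjoint (replicate (suc k) x ʳ++ s) l
pushLeadingBlock x k l s s-free d x∉l rewrite replicate-ʳ++ (suc k) x s =
    trans (hasABA-replicate-++ x (suc k) (Disjoint-head {s} d)) s-free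
  , Disjoint-++ {replicate (suc k) x} {s} (Disjoint-replicate (suc k) x∉l)
                (λ z z∈s → ∉-++⁻ʳ (replicate k x) (∉-tail (d z z∈s)))

-- q is split at the first occurrence of a scattered sock; the socks of the prefix form complete
-- blocks not met again, so once pushed onto s they stay at the bottom of the stack for good.
record FirstScattered (s q : SockSeq) : Set where
  field
    prefix         : SockSeq
    sock           : ℕ
    suffix         : SockSeq
    split          : q ≡ prefix ++ sock ∷ suffix
    sock-scattered : scattered sock q ≡ true
    stack-free     : AbaFree (prefix ʳ++ s)
    stack-inert    : Disjoint (prefix ʳ++ s) (sock ∷ suffix)

firstScattered : ∀ n q s → length q ≤ n → hasABA q ≡ true → AbaFree s → Disjoint s q → FirstScattered s q
firstScattered (suc n) (x ∷ xs) s (s≤s q≤n) hit s-free d with reappears x xs in re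
... | true  = record
  { prefix = [] ; sock = x ; suffix = xs ; split = refl
  ; sock-scattered = trans (cong (if_then reappears x xs else scattered x xs) (≡ᵇ-refl x)) re
  ; stack-free = s-free ; stack-inert = d }
... | false with ¬reappears⇒leadingBlock x xs re
...   | k , l , refl , x∉l = record
  { prefix = x ∷ replicate k x ++ u ; sock = a ; suffix = rest
  ; split = cong (x ∷_) (trans (cong (replicate k x ++_) split)
                               (sym (List.++-assoc (replicate k x) u (a ∷ rest))))
  ; sock-scattered = trans (scattered-replicate-++ a x (suc k) l a≢x) sock-scattered
  ; stack-free = subst AbaFree (sym u-stack) stack-free
  ; stack-inert = subst (λ b → Disjoint b (a ∷ rest)) (sym u-stack) stack-inert
  }
  where
  s′-free-inert = pushLeadingBlock x k l s s-free d x∉l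
  open FirstScattered
    (firstScattered n l (replicate (suc k) x ʳ++ s) (ℕ.≤-trans (List.length-++-≤ʳ l {replicate k x}) q≤n)
      (trans (sym (hasABA-replicate-++ x k x∉l)) hit) (proj₁ s′-free-inert) (proj₂ s′-free-inert))
    renaming (prefix to u; sock to a; suffix to rest)
  u-stack : (x ∷ replicate k x ++ u) ʳ++ s ≡ u ʳ++ replicate (suc k) x ʳ++ s
  u-stack = List.++-ʳ++ (replicate k x) {u} {x ∷ s}
  a≢x : (a ≡ᵇ x) ≡ false
  a≢x = ∈ᵇ∧∉⇒≢ᵇ a x l (scattered⇒∈ᵇ a l sock-scattered) x∉l

φ-gathers-scattered-sock : ∀ q → hasABA q ≡ true →
  ∃[ a ] scattered a q ≡ true × scattered a (φ aba q) ≡ false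
φ-gathers-scattered-sock q hit =
  sock , sock-scattered , gathered (run-gathers-bottom-block sock suffix [] 0 ∉-[])
  where
  open FirstScattered (firstScattered (length q) q [] ℕ.≤-refl hit refl (λ _ ()))
  base = prefix ʳ++ []
  gathered : GatheredAtEnd sock (run aba suffix [ sock ]) → scattered sock (φ aba q) ≡ false
  gathered (w , m , eq , a∉w) =
    SingleBlock⇒contiguous (w , base , φq , a∉w , Disjoint-head {base} stack-inert)
    where
    open ≡-Reasoning
    φq : φ aba q ≡ w ++ sock ∷ replicate m sock ++ base
    φq = begin
      run aba q []                           ≡⟨ cong (λ l → run aba l []) split ⟩
      run aba (prefix ++ sock ∷ suffix) []   ≡⟨ run-push prefix (sock ∷ suffix) [] stack-free ⟩
      run aba (sock ∷ suffix) base
        ≡⟨ run-ignores-bottom stack-free (sock ∷ suffix) [] stack-inert (Disjoint-[] base) ⟩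
      run aba (sock ∷ suffix) [] ++ base     ≡⟨ cong (_++ base) eq ⟩
      (w ++ sock ∷ replicate m sock) ++ base ≡⟨ List.++-assoc w (sock ∷ replicate m sock) base ⟩
      w ++ sock ∷ replicate m sock ++ base   ∎

SortsEventually : SockSeq → Set
SortsEventually σ = ∀ (p : SockSeq) → ∃[ k ] Sorted (iter (φ σ) k p)

scatteredCount : SockSeq → SockSeq → ℕ
scatteredCount []      q = 0
scatteredCount (b ∷ L) q = (if scattered b q then 1 else 0) + scatteredCount L q

ContiguityPreserved : SockSeq → SockSeq → Set
ContiguityPreserved q q′ = ∀ c → scattered c q ≡ false → scattered c q′ ≡ false

scatteredIndicator-mono : ∀ b q q′ → ContiguityPreserved q q′ →
  (if scattered b q′ then 1 else 0) ≤ (if scattered b q then 1 else 0)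
scatteredIndicator-mono b q q′ pres with scattered b q in sc | scattered b q′ in sc′
... | true  | true  = ℕ.≤-refl
... | _     | false = z≤n
... | false | true  with () ← trans (sym sc′) (pres b sc)

scatteredCount-mono : ∀ L q q′ → ContiguityPreserved q q′ → scatteredCount L q′ ≤ scatteredCount L q
scatteredCount-mono []      q q′ pres = z≤n
scatteredCount-mono (b ∷ L) q q′ pres =
  ℕ.+-mono-≤ (scatteredIndicator-mono b q q′ pres) (scatteredCount-mono L q q′ pres)

scatteredCount-strict : ∀ L q q′ a → ContiguityPreserved q q′ → (a ∈ᵇ L) ≡ true →
  scattered a q ≡ true → scattered a q′ ≡ false → scatteredCount L q′ < scatteredCount L q
scatteredCount-strict (b ∷ L) q q′ a pres a∈L sc sc′ with a ≡ᵇ b in a≡b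
... | true  with refl ← ≡ᵇ⇒≡ a b a≡b rewrite sc | sc′ = s≤s (scatteredCount-mono L q q′ pres)
... | false =
  ℕ.+-mono-≤-< (scatteredIndicator-mono b q q′ pres) (scatteredCount-strict L q q′ a pres a∈L sc sc′)

∈ᵇ-iterate-φ : ∀ z p j → (z ∈ᵇ iter (φ aba) j p) ≡ true → (z ∈ᵇ p) ≡ true
∈ᵇ-iterate-φ z p j z∈ with z ∈ᵇ p in z∈p
... | true  = refl
... | false = ⊥-elim (∈ᵇ⇒¬∉ z∈ (∉-iterate j))
  where
  ∉-iterate : ∀ j → z ∉ iter (φ aba) j p
  ∉-iterate zero    = absent z∈p
  ∉-iterate (suc j) = ∉-run (iter (φ aba) j p) [] (∉-iterate j) ∉-[]

¬reappears⇒lookup≡ : ∀ x xs → reappears x xs ≡ false → ∀ (j k : Fin (length xs)) →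
  toℕ j < toℕ k → lookup xs k ≡ x → lookup xs j ≡ x
¬reappears⇒lookup≡ x (y ∷ ys) ¬re j k j<k e with x ≡ᵇ y in x≡y
¬reappears⇒lookup≡ x (y ∷ ys) ¬re zero    k       j<k       _ | true = sym (≡ᵇ⇒≡ x y x≡y)
¬reappears⇒lookup≡ x (y ∷ ys) ¬re (suc j) (suc k) (s≤s j<k) e | true =
  ¬reappears⇒lookup≡ x ys ¬re j k j<k e
¬reappears⇒lookup≡ x (y ∷ ys) ¬re j       (suc k) _         e | false =
  ⊥-elim (∈ᵇ⇒¬∉ {x} {ys} (subst (λ z → (z ∈ᵇ ys) ≡ true) e (∈ᵇ-lookup ys k)) (absent ¬re))

AbaFree⇒Sorted : ∀ q → AbaFree q → Sorted q
AbaFree⇒Sorted (x ∷ xs) free zero    (suc j) (suc k) _         (s≤s j<k) e =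
  ¬reappears⇒lookup≡ x xs (∨-conicalˡ (reappears x xs) (hasABA xs) free) j k j<k (sym e)
AbaFree⇒Sorted (x ∷ xs) free (suc i) (suc j) (suc k) (s≤s i<j) (s≤s j<k) e =
  AbaFree⇒Sorted xs (∨-conicalʳ (reappears x xs) (hasABA xs) free) i j k i<j j<k e

φ-sorts-within : ∀ p n j → scatteredCount p (iter (φ aba) j p) < n → ∃[ k ] Sorted (iter (φ aba) k p)
φ-sorts-within p (suc n) j count<n with hasABA (iter (φ aba) j p) in hit
... | false = j , AbaFree⇒Sorted (iter (φ aba) j p) hit
... | true  with φ-gathers-scattered-sock (iter (φ aba) j p) hit
...   | a , sc , sc′ = φ-sorts-within p n (suc j) (ℕ.<-≤-trans decrease (ℕ.≤-pred count<n))
  where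
  decrease = scatteredCount-strict p _ _ a (λ c → φ-preserves-contiguity c (iter (φ aba) j p))
               (∈ᵇ-iterate-φ a p j (scattered⇒∈ᵇ a (iter (φ aba) j p) sc)) sc sc′

φ-aba-eventually-sorts : SortsEventually aba
φ-aba-eventually-sorts p = φ-sorts-within p (suc (scatteredCount p p)) 0 ℕ.≤-refl

iter-fixed : ∀ {A : Set} (g : A → A) {a} → g a ≡ a → ∀ k → iter g k a ≡ a
iter-fixed g ga≡a zero    = refl
iter-fixed g ga≡a (suc k) = trans (cong g (iter-fixed g ga≡a k)) ga≡a

iter-swap : ∀ {A : Set} (g : A → A) {a b} → g a ≡ b → g b ≡ a → ∀ k → iter g k a ≡ a ⊎ iter g k a ≡ b
iter-swap g ga≡b gb≡a zero = inj₁ refl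
iter-swap g ga≡b gb≡a (suc k) with iter-swap g ga≡b gb≡a k
... | inj₁ eq = inj₂ (trans (cong g eq) ga≡b)
... | inj₂ eq = inj₁ (trans (cong g eq) gb≡a)

¬Sorted-xyx : ∀ x y r → x ≢ y → ¬ Sorted (x ∷ y ∷ x ∷ r)
¬Sorted-xyx x y r x≢y sorted =
  x≢y (sym (sorted zero (suc zero) (suc (suc zero)) (s≤s z≤n) (s≤s (s≤s z≤n)) refl))

fixing-aba⇒¬SortsEventually : ∀ σ → φ σ aba ≡ aba → ¬ SortsEventually σ
fixing-aba⇒¬SortsEventually σ fixed sorts with sorts aba
... | k , sorted = ¬Sorted-xyx 0 1 [] (λ ()) (subst Sorted (iter-fixed (φ σ) fixed k) sorted)

¬SortsEventually-aa : ¬ SortsEventually (0 ∷ 0 ∷ [])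
¬SortsEventually-aa sorts with sorts (0 ∷ 1 ∷ 0 ∷ 1 ∷ [])
... | k , sorted with iter-swap (φ (0 ∷ 0 ∷ [])) refl refl k
...   | inj₁ eq = ¬Sorted-xyx 0 1 (1 ∷ []) (λ ()) (subst Sorted eq sorted)
...   | inj₂ eq = ¬Sorted-xyx 1 0 (0 ∷ []) (λ ()) (subst Sorted eq sorted)

-- No stack of at most three socks contains σ, so φ σ pushes everything and then reverses.
φ-long-fixes-aba : ∀ a b c d r → φ (a ∷ b ∷ c ∷ d ∷ r) aba ≡ aba
φ-long-fixes-aba a b c d r
  with contains (1 ∷ 0 ∷ []) σ | contains-short σ (1 ∷ 0 ∷ []) (s≤s (s≤s (s≤s z≤n)))
     | contains aba σ          | contains-short σ aba (s≤s (s≤s (s≤s (s≤s z≤n))))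
  where σ = a ∷ b ∷ c ∷ d ∷ r
... | .false | refl | .false | refl = refl

SortsEventually⇒aba : ∀ σ → IsPattern σ → 2 ≤ length σ → SortsEventually σ → σ ≡ aba
SortsEventually⇒aba (0 ∷ 0 ∷ [])         _ _ sorts = ⊥-elim (¬SortsEventually-aa sorts)
SortsEventually⇒aba (0 ∷ 1 ∷ [])         _ _ sorts = ⊥-elim (fixing-aba⇒¬SortsEventually _ refl sorts)
SortsEventually⇒aba (0 ∷ 0 ∷ 0 ∷ [])     _ _ sorts = ⊥-elim (fixing-aba⇒¬SortsEventually _ refl sorts)
SortsEventually⇒aba (0 ∷ 0 ∷ 1 ∷ [])     _ _ sorts = ⊥-elim (fixing-aba⇒¬SortsEventually _ refl sorts)
SortsEventually⇒aba (0 ∷ 1 ∷ 0 ∷ [])     _ _ sorts = refl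
SortsEventually⇒aba (0 ∷ 1 ∷ 1 ∷ [])     _ _ sorts = ⊥-elim (fixing-aba⇒¬SortsEventually _ refl sorts)
SortsEventually⇒aba (0 ∷ 1 ∷ 2 ∷ [])     _ _ sorts = ⊥-elim (fixing-aba⇒¬SortsEventually _ refl sorts)
SortsEventually⇒aba (a ∷ b ∷ c ∷ d ∷ r)  _ _ sorts =
  ⊥-elim (fixing-aba⇒¬SortsEventually _ (φ-long-fixes-aba a b c d r) sorts)
SortsEventually⇒aba (a ∷ [])             _ (s≤s ())
SortsEventually⇒aba (suc a ∷ b ∷ [])     ()
SortsEventually⇒aba (0 ∷ suc (suc b) ∷ []) ()
SortsEventually⇒aba (suc a ∷ b ∷ c ∷ []) ()
SortsEventually⇒aba (0 ∷ suc (suc b) ∷ c ∷ []) ()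
SortsEventually⇒aba (0 ∷ 0 ∷ suc (suc c) ∷ []) ()
SortsEventually⇒aba (0 ∷ 1 ∷ suc (suc (suc c)) ∷ []) ()

proposition5p1 : (σ : SockSeq) → IsPattern σ → 2 ≤ length σ →
    ((∀ (p : SockSeq) → ∃[ k ] Sorted (iter (φ σ) k p)) ⇔ (σ ≡ aba))
proposition5p1 σ isPattern 2≤|σ| =
  mk⇔ (SortsEventually⇒aba σ isPattern 2≤|σ|) λ { refl → φ-aba-eventually-sorts }
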